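{- Let $P$ be the infinite matrix indexed by the non-negative integers with $P(r+1,r)=1$, $P(r,r)=r-1$, $P(r,r+1)=-r-1$ for $r\geq0$, and $P(r,s)=0$ for $|r-s|>1$, and let $d_m=3\cdot 2^m$. Then: (a) for all block indices $0\le a\le b$, every entry of $P^3-I$ in rows $\{2a,2a+1\}$ and columns $\{2b,2b+1\}$ is even; (b) for all block indices $a,b\geq 0$ with $b\geq a-3$, every entry of $P^{48}-I$ in rows $\{8a,\dots,8a+7\}$ and columns $\{8b,\dots,8b+7\}$ is even; (c) if $m\geq 3$, $0\leq r\leq 7$ and $s\geq d_{m-1}+8$, then $\nu_2\bigl(P^{d_m}(r,s)\bigr)\geq m+7$.
   Context: $\nu_2$ denotes the $2$-adic valuation, with $\nu_2(0)=\infty$. $I$ is the identity matrix. Parts (a) and (b) are the statements that the $2$-block form of $P^3-I$ is strictly lower triangular modulo $2$ (blocks on and above the block diagonal are even), and that in the $8$-block form of $P^{48}-I=P^{d_4}-I$ all upper block diagonals, the main block diagonal and the first three lower block diagonals are even. -}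

module Defs where

open import Data.Nat as ℕ using (ℕ; zero; suc; _≟_)
open import Data.Integer as ℤ using (ℤ; +_; -_; 0ℤ; 1ℤ)
open import Relation.Nullary using (yes; no)

P : ℕ → ℕ → ℤ
P r s with r ≟ s | suc r ≟ s | r ≟ suc s
... | yes _ | _     | _     = (+ r) ℤ.- 1ℤ
... | no _  | yes _ | _     = - (+ suc r)
... | no _  | no _  | yes _ = 1ℤ
... | no _  | no _  | no _  = 0ℤ

δ : ℕ → ℕ → ℤ
δ r s with r ≟ s
... | yes _ = 1ℤ
... | no _  = 0ℤ

sumTo : ℕ → (ℕ → ℤ) → ℤ
sumTo zero    f = 0ℤ
sumTo (suc n) f = sumTo n f ℤ.+ f n

-- Entries of P^n, via P^(n+1) = P^n · P.  The product sum
-- (P^n · P)(r,s) = Σ_k P^n(r,k) P(k,s) is over all k ∈ ℕ, but P(k,s) = 0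
-- for k ≥ s + 2, so the sum over k < s + 2 is exactly the full sum.
Ppow : ℕ → ℕ → ℕ → ℤ
Ppow zero    r s = δ r s
Ppow (suc n) r s = sumTo (s ℕ.+ 2) (λ k → Ppow n r k ℤ.* P k s)

d : ℕ → ℕ
d m = 3 ℕ.* (2 ℕ.^ m)

{-# OPTIONS --safe #-}

-- Modulo 2 the matrix P is invariant under the diagonal shift (r, s) ↦ (r + 2, s + 2),
-- the only boundary term P(1, 2) = -2 being even; hence
-- P^n(r + 2c, s + 2c) ≡ P^n(r, s) (mod 2), and (a), (b) reduce to a finite computation:
-- rows 0, 1 of P³ and rows 24, …, 31 of P⁴⁸ agree with the identity modulo 2.
-- For (c), P(k, k + 1) = -(k + 1) and P(k, s) = 0 for k ≥ s + 2, so by induction on n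
-- the product (r + 1)(r + 2)⋯s divides P^n(r, s) for every n.  For r ≤ 7 this product
-- contains the s - 7 ≥ d_{m-1} + 1 consecutive factors 8, 9, …, s, which supply
-- m + 7 factors of 2.

module Submission where

open import Defs
open import Data.Integer.Divisibility using (_∣_)
open import Data.Integer.Divisibility.Signed as ℤ∣ using (∣ᵤ⇒∣; ∣⇒∣ᵤ)
open import Data.Nat using (ℕ; zero; suc; _≤_; _<_; _+_; _*_; _^_; _∸_; _≟_; parity; s≤s)
import Data.Nat.Properties as ℕP
import Data.Nat.Divisibility as ℕ∣
open import Data.Nat.Tactic.RingSolver using (solve-∀)
open import Data.Integer as ℤ using (ℤ; +_; -_; -[1+_]; 0ℤ; 1ℤ; -1ℤ; _⊖_)
import Data.Integer.Properties as ℤP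
open import Data.Parity as ℙ using (Parity; 0ℙ; 1ℙ; _⁻¹)
import Data.Parity.Properties as ℙP
open import Data.List using (List; []; _∷_; _++_; replicate)
open import Data.List.Properties using (≡-dec)
open import Data.Product using (_×_; _,_)
open import Relation.Nullary using (yes; no; contradiction)
open import Relation.Nullary.Decidable using (True; toWitness)
open import Relation.Binary.PropositionalEquality

P-diagonal : ∀ s → P s s ≡ + s ℤ.- 1ℤ
P-diagonal s with s ≟ s
... | yes _   = refl
... | no s≢s  = contradiction refl s≢s

P-super : ∀ s → P s (suc s) ≡ - (+ suc s)
P-super s with s ≟ suc s | suc s ≟ suc s
... | yes s≡1+s | _         = contradiction (sym s≡1+s) (ℕP.1+n≢n)
... | no _      | yes _     = refl
... | no _      | no 1+s≢1+s = contradiction refl 1+s≢1+s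

P-sub : ∀ s → P (suc s) s ≡ 1ℤ
P-sub s with suc s ≟ s | suc (suc s) ≟ s | suc s ≟ suc s
... | yes 1+s≡s | _         | _          = contradiction 1+s≡s ℕP.1+n≢n
... | no _      | yes 2+s≡s | _          = contradiction (sym 2+s≡s) (ℕP.m≢1+n+m s)
... | no _      | no _      | yes _      = refl
... | no _      | no _      | no 1+s≢1+s = contradiction refl 1+s≢1+s

P-far : ∀ k s → 2 + k ≤ s → P k s ≡ 0ℤ
P-far k s 2+k≤s with k ≟ s | suc k ≟ s | k ≟ suc s
... | yes refl | _        | _        = contradiction 2+k≤s (ℕP.≤⇒≯ (ℕP.n≤1+n k))
... | no _     | yes refl | _        = contradiction 2+k≤s (ℕP.≤⇒≯ ℕP.≤-refl)
... | no _     | no _     | yes refl = contradiction 2+k≤s (ℕP.≤⇒≯ (ℕP.m≤n+m s 2))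
... | no _     | no _     | no _     = refl

δ-suc : ∀ r s → δ (suc r) (suc s) ≡ δ r s
δ-suc r s with r ≟ s | suc r ≟ suc s
... | yes _   | yes _   = refl
... | yes r≡s | no ≢    = contradiction (cong suc r≡s) ≢
... | no r≢s  | yes ≡   = contradiction (ℕP.suc-injective ≡) r≢s
... | no _    | no _    = refl

δ-off : ∀ r s → r ≢ s → δ r s ≡ 0ℤ
δ-off r s r≢s with r ≟ s
... | yes r≡s = contradiction r≡s r≢s
... | no _    = refl

sumTo-zero : ∀ N f → (∀ k → k < N → f k ≡ 0ℤ) → sumTo N f ≡ 0ℤ
sumTo-zero zero    f _    = refl
sumTo-zero (suc N) f f≡0 =
  cong₂ ℤ._+_ (sumTo-zero N f (λ k k<N → f≡0 k (ℕP.m<n⇒m<1+n k<N))) (f≡0 N ℕP.≤-refl)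

Ppow-suc-zero : ∀ n r → Ppow (suc n) r 0 ≡ -1ℤ ℤ.* Ppow n r 0 ℤ.+ Ppow n r 1
Ppow-suc-zero n r = cong₂ ℤ._+_
  (trans (ℤP.+-identityˡ _) (ℤP.*-comm (Ppow n r 0) -1ℤ))
  (ℤP.*-identityʳ (Ppow n r 1))

Ppow-suc-suc : ∀ n r s → Ppow (suc n) r (suc s)
             ≡ -[1+ s ] ℤ.* Ppow n r s ℤ.+ + s ℤ.* Ppow n r (suc s) ℤ.+ Ppow n r (suc (suc s))
Ppow-suc-suc n r s = begin
  sumTo (suc s + 2) g
    ≡⟨ cong (λ N → sumTo N g) (ℕP.+-comm (suc s) 2) ⟩
  sumTo s g ℤ.+ g s ℤ.+ g (suc s) ℤ.+ g (suc (suc s))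
    ≡⟨ cong (λ z → z ℤ.+ g s ℤ.+ g (suc s) ℤ.+ g (suc (suc s))) (sumTo-zero s g far) ⟩
  0ℤ ℤ.+ g s ℤ.+ g (suc s) ℤ.+ g (suc (suc s))
    ≡⟨ cong₂ ℤ._+_ (cong₂ ℤ._+_ (trans (ℤP.+-identityˡ (g s)) (coefficient s (P-super s)))
                                (coefficient (suc s) (P-diagonal (suc s))))
                   (trans (cong (Ppow n r (suc (suc s)) ℤ.*_) (P-sub (suc s))) (ℤP.*-identityʳ _)) ⟩
  -[1+ s ] ℤ.* Ppow n r s ℤ.+ + s ℤ.* Ppow n r (suc s) ℤ.+ Ppow n r (suc (suc s)) ∎
  where
  open ≡-Reasoning
  g : ℕ → ℤ
  g k = Ppow n r k ℤ.* P k (suc s)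
  far : ∀ k → k < s → g k ≡ 0ℤ
  far k k<s = trans (cong (Ppow n r k ℤ.*_) (P-far k (suc s) (s≤s k<s))) (ℤP.*-zeroʳ (Ppow n r k))
  coefficient : ∀ k {a} → P k (suc s) ≡ a → g k ≡ a ℤ.* Ppow n r k
  coefficient k {a} P≡a = trans (cong (Ppow n r k ℤ.*_) P≡a) (ℤP.*-comm (Ppow n r k) a)

parity-suc : ∀ n → parity (suc n) ≡ parity n ⁻¹
parity-suc n = trans (sym (ℙP.⁻¹-involutive _)) (cong _⁻¹ (ℙP.suc-homo-⁻¹ n))

⁻¹-+-⁻¹ : ∀ p q → p ⁻¹ ℙ.+ q ⁻¹ ≡ p ℙ.+ q
⁻¹-+-⁻¹ 0ℙ q = ℙP.⁻¹-involutive q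
⁻¹-+-⁻¹ 1ℙ q = refl

parity-suc-+-suc : ∀ m n → parity (suc m) ℙ.+ parity (suc n) ≡ parity m ℙ.+ parity n
parity-suc-+-suc m n = trans (cong₂ ℙ._+_ (parity-suc m) (parity-suc n)) (⁻¹-+-⁻¹ (parity m) (parity n))

even⇒2∣ : ∀ n → parity n ≡ 0ℙ → 2 ℕ∣.∣ n
even⇒2∣ zero          _    = ℕ∣._∣0 2
even⇒2∣ (suc (suc n)) even = ℕ∣.∣m∣n⇒∣m+n ℕ∣.∣-refl (even⇒2∣ n even)

ℤparity : ℤ → Parity
ℤparity i = parity ℤ.∣ i ∣

ℤparity-⊖ : ∀ m n → ℤparity (m ⊖ n) ≡ parity m ℙ.+ parity n
ℤparity-⊖ zero    zero    = refl
ℤparity-⊖ zero    (suc n) = refl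
ℤparity-⊖ (suc m) zero    = sym (ℙP.+-identityʳ _)
ℤparity-⊖ (suc m) (suc n) = begin
  ℤparity (suc m ⊖ suc n)          ≡⟨ cong ℤparity (ℤP.[1+m]⊖[1+n]≡m⊖n m n) ⟩
  ℤparity (m ⊖ n)                  ≡⟨ ℤparity-⊖ m n ⟩
  parity m ℙ.+ parity n            ≡⟨ parity-suc-+-suc m n ⟨
  parity (suc m) ℙ.+ parity (suc n) ∎
  where open ≡-Reasoning

ℤparity-+ : ∀ i j → ℤparity (i ℤ.+ j) ≡ ℤparity i ℙ.+ ℤparity j
ℤparity-+ (+ m)    (+ n)    = ℙP.+-homo-+ m n
ℤparity-+ (+ m)    -[1+ n ] = ℤparity-⊖ m (suc n)
ℤparity-+ -[1+ m ] (+ n)    = trans (ℤparity-⊖ n (suc m)) (ℙP.+-comm (parity n) (parity (suc m)))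
ℤparity-+ -[1+ m ] -[1+ n ] = trans (ℙP.+-homo-+ m n) (sym (parity-suc-+-suc m n))

ℤparity-* : ∀ i j → ℤparity (i ℤ.* j) ≡ ℤparity i ℙ.* ℤparity j
ℤparity-* i j = trans (cong parity (ℤP.abs-* i j)) (ℙP.*-homo-* ℤ.∣ i ∣ ℤ.∣ j ∣)

ℤparity-neg : ∀ i → ℤparity (- i) ≡ ℤparity i
ℤparity-neg i = cong parity (ℤP.∣-i∣≡∣i∣ i)

sameParity⇒2∣- : ∀ i j → ℤparity i ≡ ℤparity j → + 2 ∣ i ℤ.- j
sameParity⇒2∣- i j same = even⇒2∣ _ (begin
  ℤparity (i ℤ.- j)              ≡⟨ ℤparity-+ i (- j) ⟩
  ℤparity i ℙ.+ ℤparity (- j)    ≡⟨ cong₂ ℙ._+_ same (ℤparity-neg j) ⟩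
  ℤparity j ℙ.+ ℤparity j        ≡⟨ ℙP.p+p≡0ℙ (ℤparity j) ⟩
  0ℙ                             ∎)
  where open ≡-Reasoning

-- (v · P)(s) mod 2, from P(s-1,s) = -s, P(s,s) = s - 1, P(s+1,s) = 1; at s = 0
-- the junk value v (0 ∸ 1) is multiplied by parity 0 = 0ℙ.
mulP₂ : (ℕ → Parity) → ℕ → Parity
mulP₂ v s = (parity s ℙ.* v (s ∸ 1)) ℙ.+ (parity (suc s) ℙ.* v s) ℙ.+ v (suc s)

mulP₂-cong : ∀ {v w} → (∀ k → v k ≡ w k) → ∀ s → mulP₂ v s ≡ mulP₂ w s
mulP₂-cong v≗w s rewrite v≗w (s ∸ 1) | v≗w s | v≗w (suc s) = refl

mulP₂-shift : ∀ {v w} → (∀ k → v (2 + k) ≡ w k) → ∀ s → mulP₂ v (2 + s) ≡ mulP₂ w s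
mulP₂-shift shifted zero    = cong₂ ℙ._+_ (shifted 0) (shifted 1)
mulP₂-shift shifted (suc s) rewrite shifted s | shifted (suc s) | shifted (suc (suc s)) = refl

-- Opaque: otherwise comparing Ppow₂ n r s with Ppow₂ n r′ s for definitionally equal but
-- syntactically different r, r′ (such as 24 + 0 and 24) unfolds P^n, in time exponential in n.
opaque
  Ppow₂ : ℕ → ℕ → ℕ → Parity
  Ppow₂ n r s = ℤparity (Ppow n r s)

  Ppow₂-zero : ∀ r s → Ppow₂ 0 r s ≡ ℤparity (δ r s)
  Ppow₂-zero r s = refl

  Ppow₂-suc : ∀ n r s → Ppow₂ (suc n) r s ≡ mulP₂ (Ppow₂ n r) s
  Ppow₂-suc n r zero = begin
    ℤparity (Ppow (suc n) r 0)                              ≡⟨ cong ℤparity (Ppow-suc-zero n r) ⟩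
    ℤparity (-1ℤ ℤ.* Ppow n r 0 ℤ.+ Ppow n r 1)             ≡⟨ ℤparity-+ (-1ℤ ℤ.* Ppow n r 0) (Ppow n r 1) ⟩
    ℤparity (-1ℤ ℤ.* Ppow n r 0) ℙ.+ Ppow₂ n r 1            ≡⟨ cong (ℙ._+ Ppow₂ n r 1) (ℤparity-* -1ℤ (Ppow n r 0)) ⟩
    mulP₂ (Ppow₂ n r) 0                                     ∎
    where open ≡-Reasoning
  Ppow₂-suc n r (suc s) = begin
    ℤparity (Ppow (suc n) r (suc s))
      ≡⟨ cong ℤparity (Ppow-suc-suc n r s) ⟩
    ℤparity (-[1+ s ] ℤ.* Ppow n r s ℤ.+ + s ℤ.* Ppow n r (suc s) ℤ.+ Ppow n r (suc (suc s)))
      ≡⟨ trans (ℤparity-+ (X ℤ.+ Y) Z) (cong (ℙ._+ ℤparity Z) (ℤparity-+ X Y)) ⟩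
    ℤparity (-[1+ s ] ℤ.* Ppow n r s) ℙ.+ ℤparity (+ s ℤ.* Ppow n r (suc s)) ℙ.+ Ppow₂ n r (suc (suc s))
      ≡⟨ cong (ℙ._+ Ppow₂ n r (suc (suc s)))
              (cong₂ ℙ._+_ (ℤparity-* -[1+ s ] (Ppow n r s)) (ℤparity-* (+ s) (Ppow n r (suc s)))) ⟩
    (parity (suc s) ℙ.* Ppow₂ n r s) ℙ.+ (parity s ℙ.* Ppow₂ n r (suc s)) ℙ.+ Ppow₂ n r (suc (suc s))
      ≡⟨⟩
    mulP₂ (Ppow₂ n r) (suc s)
      ∎
    where
    open ≡-Reasoning
    X Y Z : ℤ
    X = -[1+ s ] ℤ.* Ppow n r s
    Y = + s ℤ.* Ppow n r (suc s)
    Z = Ppow n r (suc (suc s))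

  2∣Ppow-δ : ∀ n r s → Ppow₂ n r s ≡ Ppow₂ 0 r s → + 2 ∣ Ppow n r s ℤ.- δ r s
  2∣Ppow-δ n r s = sameParity⇒2∣- (Ppow n r s) (δ r s)

Ppow₂-shift₂ : ∀ n r s → Ppow₂ n (2 + r) (2 + s) ≡ Ppow₂ n r s
Ppow₂-shift₂ zero    r s = begin
  Ppow₂ 0 (2 + r) (2 + s)       ≡⟨ Ppow₂-zero (2 + r) (2 + s) ⟩
  ℤparity (δ (2 + r) (2 + s))   ≡⟨ cong ℤparity (trans (δ-suc (suc r) (suc s)) (δ-suc r s)) ⟩
  ℤparity (δ r s)               ≡⟨ Ppow₂-zero r s ⟨
  Ppow₂ 0 r s                   ∎
  where open ≡-Reasoning
Ppow₂-shift₂ (suc n) r s = begin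
  Ppow₂ (suc n) (2 + r) (2 + s)    ≡⟨ Ppow₂-suc n (2 + r) (2 + s) ⟩
  mulP₂ (Ppow₂ n (2 + r)) (2 + s)  ≡⟨ mulP₂-shift {Ppow₂ n (2 + r)} {Ppow₂ n r} (Ppow₂-shift₂ n r) s ⟩
  mulP₂ (Ppow₂ n r) s              ≡⟨ Ppow₂-suc n r s ⟨
  Ppow₂ (suc n) r s                ∎
  where open ≡-Reasoning

Ppow₂-shift : ∀ n c r s → Ppow₂ n (2 * c + r) (2 * c + s) ≡ Ppow₂ n r s
Ppow₂-shift n zero    r s = refl
Ppow₂-shift n (suc c) r s = begin
  Ppow₂ n (2 * suc c + r) (2 * suc c + s)          ≡⟨ cong₂ (Ppow₂ n) (twice-suc r) (twice-suc s) ⟩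
  Ppow₂ n (2 + (2 * c + r)) (2 + (2 * c + s))      ≡⟨ Ppow₂-shift₂ n (2 * c + r) (2 * c + s) ⟩
  Ppow₂ n (2 * c + r) (2 * c + s)                  ≡⟨ Ppow₂-shift n c r s ⟩
  Ppow₂ n r s                                      ∎
  where
  open ≡-Reasoning
  twice-suc : ∀ x → 2 * suc c + x ≡ 2 + (2 * c + x)
  twice-suc x = trans (cong (_+ x) (ℕP.*-suc 2 c)) (ℕP.+-assoc 2 (2 * c) x)

AgreesWithI₂ : ℕ → ℕ → ℕ → Set
AgreesWithI₂ n r s = Ppow₂ n r s ≡ Ppow₂ 0 r s

RowAgreesWithI₂ : ℕ → ℕ → Set
RowAgreesWithI₂ n r = ∀ s → AgreesWithI₂ n r s

RowAgreesWithI₂-up : ∀ {n r} c → RowAgreesWithI₂ n (2 * c + r) → RowAgreesWithI₂ n r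
RowAgreesWithI₂-up {n} {r} c agrees s = begin
  Ppow₂ n r s                          ≡⟨ Ppow₂-shift n c r s ⟨
  Ppow₂ n (2 * c + r) (2 * c + s)      ≡⟨ agrees (2 * c + s) ⟩
  Ppow₂ 0 (2 * c + r) (2 * c + s)      ≡⟨ Ppow₂-shift 0 c r s ⟩
  Ppow₂ 0 r s                          ∎
  where open ≡-Reasoning

RowAgreesWithI₂-down : ∀ {n r} → RowAgreesWithI₂ n r →
  ∀ c t → AgreesWithI₂ n (2 * c + r) (2 * c + t)
RowAgreesWithI₂-down {n} {r} agrees c t = begin
  Ppow₂ n (2 * c + r) (2 * c + t)      ≡⟨ Ppow₂-shift n c r t ⟩
  Ppow₂ n r t                          ≡⟨ agrees t ⟩
  Ppow₂ 0 r t                          ≡⟨ Ppow₂-shift 0 c r t ⟨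
  Ppow₂ 0 (2 * c + r) (2 * c + t)      ∎
  where open ≡-Reasoning

entry : List Parity → ℕ → Parity
entry []       _       = 0ℙ
entry (x ∷ _)  zero    = x
entry (_ ∷ xs) (suc s) = entry xs s

entry-++-replicate : ∀ xs k s → entry (xs ++ replicate k 0ℙ) s ≡ entry xs s
entry-++-replicate []       zero    s       = refl
entry-++-replicate []       (suc k) zero    = refl
entry-++-replicate []       (suc k) (suc s) = entry-++-replicate [] k s
entry-++-replicate (x ∷ xs) k       zero    = refl
entry-++-replicate (x ∷ xs) k       (suc s) = entry-++-replicate xs k s

-- Computes the entries i, i+1, ... of v · P mod 2 from prev = v (i - 1) and the list
-- v i, v (i+1), ...
mulP₂-from : ℕ → Parity → List Parity → List Parity
mulP₂-from i prev []       = parity i ℙ.* prev ∷ []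
mulP₂-from i prev (x ∷ xs) =
  (parity i ℙ.* prev) ℙ.+ (parity (suc i) ℙ.* x) ℙ.+ entry xs 0 ∷ mulP₂-from (suc i) x xs

entry-mulP₂-from : ∀ i prev xs s → entry (mulP₂-from i prev xs) s
  ≡ (parity (s + i) ℙ.* entry (prev ∷ xs) s) ℙ.+ (parity (suc s + i) ℙ.* entry xs s) ℙ.+ entry xs (suc s)
entry-mulP₂-from i prev [] zero
  rewrite ℙP.*-zeroʳ (parity (suc i)) | ℙP.+-identityʳ (parity i ℙ.* prev) = sym (ℙP.+-identityʳ _)
entry-mulP₂-from i prev [] (suc s)
  rewrite ℙP.*-zeroʳ (parity (suc s + i)) | ℙP.*-zeroʳ (parity (suc (suc s) + i)) = refl
entry-mulP₂-from i prev (x ∷ xs) zero    = refl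
entry-mulP₂-from i prev (x ∷ xs) (suc s) =
  trans (entry-mulP₂-from (suc i) x xs s)
        (cong (λ j → (parity j ℙ.* entry (x ∷ xs) s) ℙ.+ (parity (suc j) ℙ.* entry xs s) ℙ.+ entry xs (suc s))
              (ℕP.+-suc s i))

mulP₂-list : List Parity → List Parity
mulP₂-list = mulP₂-from 0 0ℙ

entry-mulP₂-list : ∀ xs s → entry (mulP₂-list xs) s ≡ mulP₂ (entry xs) s
entry-mulP₂-list xs zero    = entry-mulP₂-from 0 0ℙ xs 0
entry-mulP₂-list xs (suc s) =
  trans (entry-mulP₂-from 0 0ℙ xs (suc s))
        (cong (λ j → (parity (suc j) ℙ.* entry xs s) ℙ.+ (parity (suc (suc j)) ℙ.* entry xs (suc s))
                     ℙ.+ entry xs (suc (suc s)))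
              (ℕP.+-identityʳ s))

rowList₂ : ℕ → ℕ → List Parity
rowList₂ zero    r = replicate r 0ℙ ++ 1ℙ ∷ []
rowList₂ (suc n) r = mulP₂-list (rowList₂ n r)

entry-rowList₂ : ∀ n r s → entry (rowList₂ n r) s ≡ Ppow₂ n r s
entry-rowList₂ zero    r       s       = trans (entry-unit r s) (sym (Ppow₂-zero r s))
  where
  entry-unit : ∀ r s → entry (rowList₂ 0 r) s ≡ ℤparity (δ r s)
  entry-unit zero    zero    = refl
  entry-unit zero    (suc s) = refl
  entry-unit (suc r) zero    = refl
  entry-unit (suc r) (suc s) = trans (entry-unit r s) (cong ℤparity (sym (δ-suc r s)))
entry-rowList₂ (suc n) r       s       = begin
  entry (mulP₂-list (rowList₂ n r)) s   ≡⟨ entry-mulP₂-list (rowList₂ n r) s ⟩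
  mulP₂ (entry (rowList₂ n r)) s        ≡⟨ mulP₂-cong (entry-rowList₂ n r) s ⟩
  mulP₂ (Ppow₂ n r) s                   ≡⟨ Ppow₂-suc n r s ⟨
  Ppow₂ (suc n) r s                     ∎
  where open ≡-Reasoning

RowAgreesWithI₂-byComputation : ∀ n r →
  True (≡-dec ℙP._≟_ (rowList₂ n r) (rowList₂ 0 r ++ replicate n 0ℙ)) → RowAgreesWithI₂ n r
RowAgreesWithI₂-byComputation n r row≡unit? s = begin
  Ppow₂ n r s                                 ≡⟨ entry-rowList₂ n r s ⟨
  entry (rowList₂ n r) s                      ≡⟨ cong (λ xs → entry xs s) (toWitness row≡unit?) ⟩
  entry (rowList₂ 0 r ++ replicate n 0ℙ) s    ≡⟨ entry-++-replicate (rowList₂ 0 r) n s ⟩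
  entry (rowList₂ 0 r) s                      ≡⟨ entry-rowList₂ 0 r s ⟩
  Ppow₂ 0 r s                                 ∎
  where open ≡-Reasoning

P³-rows : ∀ i → i < 2 → RowAgreesWithI₂ 3 i
P³-rows 0 _ = RowAgreesWithI₂-byComputation 3 0 _
P³-rows 1 _ = RowAgreesWithI₂-byComputation 3 1 _
P³-rows (suc (suc _)) (s≤s (s≤s ()))

P⁴⁸-rows : ∀ i → i < 8 → RowAgreesWithI₂ 48 (24 + i)
P⁴⁸-rows 0 _ = RowAgreesWithI₂-byComputation 48 24 _
P⁴⁸-rows 1 _ = RowAgreesWithI₂-byComputation 48 25 _
P⁴⁸-rows 2 _ = RowAgreesWithI₂-byComputation 48 26 _
P⁴⁸-rows 3 _ = RowAgreesWithI₂-byComputation 48 27 _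
P⁴⁸-rows 4 _ = RowAgreesWithI₂-byComputation 48 28 _
P⁴⁸-rows 5 _ = RowAgreesWithI₂-byComputation 48 29 _
P⁴⁸-rows 6 _ = RowAgreesWithI₂-byComputation 48 30 _
P⁴⁸-rows 7 _ = RowAgreesWithI₂-byComputation 48 31 _
P⁴⁸-rows (suc (suc (suc (suc (suc (suc (suc (suc _)))))))) (s≤s (s≤s (s≤s (s≤s (s≤s (s≤s (s≤s (s≤s ()))))))))

P³≡I-mod2 : ∀ a b i j → a ≤ b → i < 2 → AgreesWithI₂ 3 (2 * a + i) (2 * b + j)
P³≡I-mod2 a b i j a≤b i<2 =
  subst (AgreesWithI₂ 3 (2 * a + i)) column (RowAgreesWithI₂-down (P³-rows i i<2) a (2 * (b ∸ a) + j))
  where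
  column : 2 * a + (2 * (b ∸ a) + j) ≡ 2 * b + j
  column = trans (regroup a (b ∸ a) j) (cong (λ x → 2 * x + j) (ℕP.m+[n∸m]≡n a≤b))
    where
    regroup : ∀ a c j → 2 * a + (2 * c + j) ≡ 2 * (a + c) + j
    regroup = solve-∀

-- Rows 0, …, 23 are shifts of rows 24, …, 31 and agree with I everywhere; shifting rows
-- 24, …, 31 down by 8(a - 3) reaches exactly the column blocks b ≥ a - 3.
P⁴⁸≡I-mod2 : ∀ a b i j → a ≤ b + 3 → i < 8 → AgreesWithI₂ 48 (8 * a + i) (8 * b + j)
P⁴⁸≡I-mod2 0 b i j _ i<8 = RowAgreesWithI₂-up 12 (P⁴⁸-rows i i<8) (8 * b + j)
P⁴⁸≡I-mod2 1 b i j _ i<8 = RowAgreesWithI₂-up 8 (P⁴⁸-rows i i<8) (8 * b + j)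
P⁴⁸≡I-mod2 2 b i j _ i<8 = RowAgreesWithI₂-up 4 (P⁴⁸-rows i i<8) (8 * b + j)
P⁴⁸≡I-mod2 (suc (suc (suc a))) b i j a+3≤b+3 i<8 =
  subst₂ (AgreesWithI₂ 48) row column (RowAgreesWithI₂-down (P⁴⁸-rows i i<8) (4 * a) (8 * (b ∸ a) + j))
  where
  a≤b : a ≤ b
  a≤b = ℕP.+-cancelʳ-≤ 3 a b (subst (_≤ b + 3) (ℕP.+-comm 3 a) a+3≤b+3)
  row : 2 * (4 * a) + (24 + i) ≡ 8 * (3 + a) + i
  row = regroup a i
    where
    regroup : ∀ a i → 2 * (4 * a) + (24 + i) ≡ 8 * (3 + a) + i
    regroup = solve-∀
  column : 2 * (4 * a) + (8 * (b ∸ a) + j) ≡ 8 * b + j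
  column = trans (regroup a (b ∸ a) j) (cong (λ x → 8 * x + j) (ℕP.m+[n∸m]≡n a≤b))
    where
    regroup : ∀ a c j → 2 * (4 * a) + (8 * c + j) ≡ 8 * (a + c) + j
    regroup = solve-∀

risingFactorial : ℕ → ℕ → ℕ
risingFactorial x zero    = 1
risingFactorial x (suc t) = (x + t) * risingFactorial x t

risingFactorial-+ : ∀ x u v → risingFactorial x (u + v) ≡ risingFactorial (x + u) v * risingFactorial x u
risingFactorial-+ x u zero    =
  trans (cong (risingFactorial x) (ℕP.+-identityʳ u)) (sym (ℕP.*-identityˡ (risingFactorial x u)))
risingFactorial-+ x u (suc v) = begin
  risingFactorial x (u + suc v)                                    ≡⟨ cong (risingFactorial x) (ℕP.+-suc u v) ⟩
  (x + (u + v)) * risingFactorial x (u + v)                        ≡⟨ cong₂ _*_ (sym (ℕP.+-assoc x u v)) (risingFactorial-+ x u v) ⟩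
  (x + u + v) * (risingFactorial (x + u) v * risingFactorial x u)  ≡⟨ ℕP.*-assoc (x + u + v) _ _ ⟨
  risingFactorial (x + u) (suc v) * risingFactorial x u            ∎
  where open ≡-Reasoning

risingFactorial-∣-+ : ∀ x u v → risingFactorial (x + u) v ℕ∣.∣ risingFactorial x (u + v)
risingFactorial-∣-+ x u v =
  subst (risingFactorial (x + u) v ℕ∣.∣_) (sym (risingFactorial-+ x u v)) (ℕ∣.m∣m*n (risingFactorial x u))

risingFactorial-mono-∣ : ∀ x {u w} → u ≤ w → risingFactorial x u ℕ∣.∣ risingFactorial x w
risingFactorial-mono-∣ x {u} {w} u≤w =
  subst (λ z → risingFactorial x u ℕ∣.∣ risingFactorial x z) (ℕP.m+[n∸m]≡n u≤w)
    (subst (risingFactorial x u ℕ∣.∣_) (sym (risingFactorial-+ x u (w ∸ u)))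
      (ℕ∣.n∣m*n (risingFactorial (x + u) (w ∸ u))))

2∣n*[1+n] : ∀ n → 2 ℕ∣.∣ n * suc n
2∣n*[1+n] n = even⇒2∣ _ (begin
  parity (n * suc n)              ≡⟨ ℙP.*-homo-* n (suc n) ⟩
  parity n ℙ.* parity (suc n)     ≡⟨ cong (parity n ℙ.*_) (parity-suc n) ⟩
  parity n ℙ.* parity n ⁻¹        ≡⟨ ℙP.p*p⁻¹≡0ℙ (parity n) ⟩
  0ℙ                              ∎)
  where open ≡-Reasoning

2^k∣risingFactorial[2k] : ∀ k x → 2 ^ k ℕ∣.∣ risingFactorial x (2 * k)
2^k∣risingFactorial[2k] zero    x = ℕ∣.1∣ _
2^k∣risingFactorial[2k] (suc k) x =
  subst (λ t → 2 ^ suc k ℕ∣.∣ risingFactorial x t) (sym (ℕP.*-suc 2 k))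
    (subst (2 ^ suc k ℕ∣.∣_) (sym (risingFactorial-+ x 2 (2 * k)))
      (subst (2 ^ suc k ℕ∣.∣_) (ℕP.*-comm (risingFactorial x 2) _)
        (ℕ∣.*-pres-∣ two∣first-pair (2^k∣risingFactorial[2k] k (x + 2)))))
  where
  two∣first-pair : 2 ℕ∣.∣ risingFactorial x 2
  two∣first-pair = subst (2 ℕ∣.∣_) (pair x) (2∣n*[1+n] x)
    where
    pair : ∀ x → x * suc x ≡ (x + 1) * ((x + 0) * 1)
    pair = solve-∀

pos-∣ : ∀ {a b} → a ℕ∣.∣ b → + a ℤ∣.∣ + b
pos-∣ = ∣ᵤ⇒∣

Ppow-risingFactorial-∣ : ∀ n r t → + risingFactorial (suc r) t ℤ∣.∣ Ppow n r (r + t)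
Ppow-risingFactorial-∣ n       r zero    = ∣ᵤ⇒∣ {+ 1} {Ppow n r (r + 0)} (ℕ∣.1∣ _)
Ppow-risingFactorial-∣ zero    r (suc t)
  rewrite δ-off r (r + suc t) (λ r≡r+1+t → ℕP.m+1+n≢m r (sym r≡r+1+t)) = pos-∣ (ℕ∣._∣0 _)
Ppow-risingFactorial-∣ (suc n) r (suc t)
  rewrite ℕP.+-suc r t | Ppow-suc-suc n r (r + t) =
    ℤ∣.∣m∣n⇒∣m+n (ℤ∣.∣m∣n⇒∣m+n below diagonal) above
  where
  s = r + t
  A = risingFactorial (suc r) (suc t)
  column : ∀ t′ {c} → r + t′ ≡ c → + risingFactorial (suc r) t′ ℤ∣.∣ Ppow n r c
  column t′ refl = Ppow-risingFactorial-∣ n r t′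
  below : + A ℤ∣.∣ -[1+ s ] ℤ.* Ppow n r s
  below = ∣ᵤ⇒∣ (subst (A ℕ∣.∣_) (sym (ℤP.abs-* -[1+ s ] (Ppow n r s)))
                 (ℕ∣.*-monoʳ-∣ (suc s) (∣⇒∣ᵤ (column t refl))))
  diagonal : + A ℤ∣.∣ + s ℤ.* Ppow n r (suc s)
  diagonal = ℤ∣.∣n⇒∣m*n (+ s) (column (suc t) (ℕP.+-suc r t))
  above : + A ℤ∣.∣ Ppow n r (suc (suc s))
  above = ℤ∣.∣-trans (pos-∣ (risingFactorial-mono-∣ (suc r) (ℕP.n≤1+n (suc t))))
                     (column (suc (suc t)) (trans (ℕP.+-suc r (suc t)) (cong suc (ℕP.+-suc r t))))

2≤d : ∀ m → 2 ≤ d m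
2≤d m = ℕP.≤-trans (ℕP.n≤1+n 2) (ℕP.m≤m*n 3 (2 ^ m) {{ℕP.m^n≢0 2 m}})

2[4+k+7]≤d[3+k] : ∀ k → 2 * (4 + k + 7) ≤ d (3 + k)
2[4+k+7]≤d[3+k] zero    = ℕP.m≤m+n 22 2
2[4+k+7]≤d[3+k] (suc k) = begin
  2 * (4 + suc k + 7)             ≡⟨ ℕP.*-suc 2 (4 + k + 7) ⟩
  2 + 2 * (4 + k + 7)             ≤⟨ ℕP.+-mono-≤ (2≤d (3 + k)) (2[4+k+7]≤d[3+k] k) ⟩
  d (3 + k) + d (3 + k)           ≡⟨ doubling (2 ^ (3 + k)) ⟨
  d (3 + suc k)                   ∎
  where
  open ℕP.≤-Reasoning
  doubling : ∀ p → 3 * (2 * p) ≡ 3 * p + 3 * p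
  doubling = solve-∀

2^[m+7]∣risingFactorial-8 : ∀ m w → 3 ≤ m → d (m ∸ 1) + 1 ≤ w → 2 ^ (m + 7) ℕ∣.∣ risingFactorial 8 w
2^[m+7]∣risingFactorial-8 0 w () _
2^[m+7]∣risingFactorial-8 1 w (s≤s ()) _
2^[m+7]∣risingFactorial-8 2 w (s≤s (s≤s ())) _
2^[m+7]∣risingFactorial-8 3 w _ 13≤w =
  ℕ∣.∣-trans (toWitness {a? = 2 ^ 10 ℕ∣.∣? risingFactorial 8 13} _) (risingFactorial-mono-∣ 8 13≤w)
2^[m+7]∣risingFactorial-8 (suc (suc (suc (suc k)))) w _ bound =
  ℕ∣.∣-trans (2^k∣risingFactorial[2k] (4 + k + 7) 8)
    (risingFactorial-mono-∣ 8
      (ℕP.≤-trans (2[4+k+7]≤d[3+k] k) (ℕP.≤-trans (ℕP.m≤m+n (d (3 + k)) 1) bound)))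

2^[m+7]∣Ppow : ∀ n m r s → 3 ≤ m → r ≤ 7 → d (m ∸ 1) + 8 ≤ s → + (2 ^ (m + 7)) ℤ∣.∣ Ppow n r s
2^[m+7]∣Ppow n m r s 3≤m r≤7 bound = subst (λ c → + (2 ^ (m + 7)) ℤ∣.∣ Ppow n r c) r+[u+v]≡s
  (ℤ∣.∣-trans (pos-∣ (ℕ∣.∣-trans (2^[m+7]∣risingFactorial-8 m v 3≤m v-bound) 8-onwards))
              (Ppow-risingFactorial-∣ n r (u + v)))
  where
  u = 7 ∸ r
  v = s ∸ 7
  r+u≡7 : r + u ≡ 7
  r+u≡7 = ℕP.m+[n∸m]≡n r≤7
  7≤s : 7 ≤ s
  7≤s = ℕP.≤-trans (ℕP.n≤1+n 7) (ℕP.≤-trans (ℕP.m≤n+m 8 (d (m ∸ 1))) bound)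
  r+[u+v]≡s : r + (u + v) ≡ s
  r+[u+v]≡s = trans (sym (ℕP.+-assoc r u v)) (trans (cong (_+ v) r+u≡7) (ℕP.m+[n∸m]≡n 7≤s))
  v-bound : d (m ∸ 1) + 1 ≤ v
  v-bound = subst (_≤ v) (ℕP.+-∸-assoc (d (m ∸ 1)) {8} {7} (ℕP.n≤1+n 7)) (ℕP.∸-monoˡ-≤ 7 bound)
  8-onwards : risingFactorial 8 v ℕ∣.∣ risingFactorial (suc r) (u + v)
  8-onwards = subst (λ x → risingFactorial x v ℕ∣.∣ risingFactorial (suc r) (u + v)) (cong suc r+u≡7)
                    (risingFactorial-∣-+ (suc r) u v)

lemma5p3 :
      ((a b i j : ℕ) → a ≤ b → i < 2 → j < 2 →
        (+ 2) ∣ (Ppow 3 (2 * a + i) (2 * b + j) ℤ.- δ (2 * a + i) (2 * b + j)))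
    × ((a b i j : ℕ) → a ≤ b + 3 → i < 8 → j < 8 →
        (+ 2) ∣ (Ppow 48 (8 * a + i) (8 * b + j) ℤ.- δ (8 * a + i) (8 * b + j)))
    × ((m r s : ℕ) → 3 ≤ m → r ≤ 7 → d (m ∸ 1) + 8 ≤ s →
        (+ (2 ^ (m + 7))) ∣ Ppow (d m) r s)
lemma5p3 =
    (λ a b i j a≤b i<2 _ → 2∣Ppow-δ 3 _ _ (P³≡I-mod2 a b i j a≤b i<2))
  , (λ a b i j a≤b+3 i<8 _ → 2∣Ppow-δ 48 _ _ (P⁴⁸≡I-mod2 a b i j a≤b+3 i<8))
  , (λ m r s 3≤m r≤7 bound → ∣⇒∣ᵤ (2^[m+7]∣Ppow (d m) m r s 3≤m r≤7 bound))
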